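{- Let $\alpha,\alpha'$ be compositions such that $\alpha$ covers $\alpha'$ in positions $(i,j)$. Then: (i) $c_{i,k}(\alpha)=c_{i,k}(\alpha')$ for every $k\in[i+1,j]$; (ii) $c_{i,j+1}(\alpha)=1+c_{i,j}(\alpha)$ and $c_{i,j+1}(\alpha')=c_{i,j}(\alpha')$; (iii) $c_{i,k}(\alpha)>c_{i,k}(\alpha')$ for every $k>j$; (iv) for every $k\in[i+1,j-1]$, either $\alpha_k+c_{i,k}(\alpha)\geqslant\alpha_i$ or $\alpha_k+c_{i,k}(\alpha)<\alpha'_i$.
   Context: $[a,b]=\{a,\dots,b\}$. A (weak) composition is a finite sequence $\alpha=(\alpha_1,\dots,\alpha_m)$ of nonnegative integers with $\alpha_k=0$ for $k>m$; $|\alpha|=\sum_k\alpha_k$. For a composition $\alpha$, a positive integer $i$ and $j\in\mathbb{N}$, define $c_{i,j}(\alpha)$ recursively: $c_{i,j}(\alpha)=0$ if $j\leqslant i+1$; for $j>i+1$, $c_{i,j}(\alpha)=c_{i,j-1}(\alpha)+1$ if $\alpha_{j-1}<\alpha_i-c_{i,j-1}(\alpha)$ and $c_{i,j}(\alpha)=c_{i,j-1}(\alpha)$ otherwise. For compositions with $|\alpha|=|\alpha'|+1$ and positive integers $i<j$, $\alpha$ covers $\alpha'$ in positions $(i,j)$ if: (a1) $\alpha'_i\leqslant\alpha_i-1$; (a2) $\alpha'_j=\alpha_j+\alpha_i-\alpha'_i-1$; (a3) $\alpha'_k=\alpha_k$ for all $k\neq i,j$; (a4) $c_{i,j}(\alpha)=c_{i,j}(\alpha')=\alpha'_i-\alpha_j$.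 -}

module Defs where

open import Data.Nat using (ℕ; zero; suc; _+_; _∸_; _≤_; _<_; _≤?_; _<?_)
open import Data.List using (List; []; _∷_)
open import Data.Nat.ListAction using (sum)
open import Data.Product using (_×_)
open import Relation.Nullary using (yes; no; ¬_)
open import Relation.Binary.PropositionalEquality using (_≡_)

-- A (weak) composition: a finite list of naturals (α₁, …, αₘ),
-- extended by zeros beyond its length.
Composition : Set
Composition = List ℕ

-- α at (1-indexed) position k; equals 0 for k = 0 (unused) and k > m.
at : Composition → ℕ → ℕ
at []       _             = 0
at (x ∷ xs) zero          = 0
at (x ∷ xs) (suc zero)    = x
at (x ∷ xs) (suc (suc k)) = at xs (suc k)

size : Composition → ℕ
size = sum

-- c_{i,j}(α), defined by recursion on j.
-- c_{i,j} = 0 if j ≤ i+1; otherwise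
-- c_{i,j} = c_{i,j-1} + 1 if α_{j-1} < α_i - c_{i,j-1}  (written α_{j-1} + c_{i,j-1} < α_i,
-- which is the same condition over the integers), else c_{i,j-1}.
c : Composition → ℕ → ℕ → ℕ
c α i zero = 0
c α i (suc j) with suc j ≤? suc i
... | yes _ = 0
... | no _ with at α j + c α i j <? at α i
...   | yes _ = suc (c α i j)
...   | no _  = c α i j

-- α covers α' in positions (i,j), for positive integers i < j and |α| = |α'| + 1.
-- Integer equations are written additively (equivalent over ℕ):
-- (a1) α'_i ≤ α_i - 1        ⇔  α'_i + 1 ≤ α_i
-- (a2) α'_j = α_j + α_i - α'_i - 1  ⇔  α'_j + α'_i + 1 ≡ α_j + α_i
-- (a4) c(α) = c(α') = α'_i - α_j    ⇔  c(α) + α_j ≡ α'_i and c(α') + α_j ≡ α'_i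
record Covers (α α' : Composition) (i j : ℕ) : Set where
  field
    pos   : 1 ≤ i
    i<j   : i < j
    size≡ : size α ≡ size α' + 1
    a1    : at α' i + 1 ≤ at α i
    a2    : at α' j + at α' i + 1 ≡ at α j + at α i
    a3    : ∀ k → 1 ≤ k → ¬ (k ≡ i) → ¬ (k ≡ j) → at α' k ≡ at α k
    a4    : c α i j + at α j ≡ at α' i
    a4'   : c α' i j + at α j ≡ at α' i

{-# OPTIONS --safe #-}
module Submission where

open import Defs
open import Data.Nat using (ℕ; zero; suc; _+_; _≤_; _<_; _>_; _≥_; z≤n; s≤s; _≤?_; _<?_)
open import Data.Nat.Properties
open import Data.Nat.Solver using (module +-*-Solver)
open import Data.Product using (_×_; _,_; proj₁; proj₂)
open import Data.Sum using (_⊎_; inj₁; inj₂)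
open import Data.Empty using (⊥; ⊥-elim)
open import Relation.Nullary using (Dec; yes; no; ¬_)
open import Relation.Binary.PropositionalEquality
  using (_≡_; _≢_; refl; sym; trans; cong; cong₂; subst; module ≡-Reasoning)

-- Run the recursions for c_{i,·}(α) and c_{i,·}(α') side by side. Where α and α'
-- agree, the gap c_{i,k}(α) − c_{i,k}(α') stays in [0, α_i − α'_i] and never shrinks:
-- a step of the α'-counter forces a step of the α-counter. By (a4) the gap is 0 at j,
-- hence 0 before j, which gives (i) and (iv); at position j only the α-counter steps,
-- so from j+1 on the gap is positive, which gives (ii) and (iii).

c-below : ∀ α i k → k ≤ suc i → c α i k ≡ 0
c-below α i zero    _         = refl
c-below α i (suc k) (s≤s k≤i) with suc k ≤? suc i
... | yes _   = refl
... | no  k≰i = ⊥-elim (k≰i (s≤s k≤i))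

c-suc-inc : ∀ α i k → i < k → at α k + c α i k < at α i → c α i (suc k) ≡ suc (c α i k)
c-suc-inc α i k i<k lt with suc k ≤? suc i
... | yes (s≤s k≤i) = ⊥-elim (<⇒≱ i<k k≤i)
... | no _ with at α k + c α i k <? at α i
...   | yes _  = refl
...   | no ≮ = ⊥-elim (≮ lt)

c-suc-stay : ∀ α i k → i < k → ¬ (at α k + c α i k < at α i) → c α i (suc k) ≡ c α i k
c-suc-stay α i k i<k ≮ with suc k ≤? suc i
... | yes (s≤s k≤i) = ⊥-elim (<⇒≱ i<k k≤i)
... | no _ with at α k + c α i k <? at α i
...   | yes lt = ⊥-elim (≮ lt)
...   | no _   = refl

module GapComparison (α β : Composition) (i : ℕ) (βᵢ≤αᵢ : at β i ≤ at α i) where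

  private
    A = at α i
    B = at β i
    C = c α i
    D = c β i

  GapWithin : ℕ → Set
  GapWithin m = (D m ≤ C m) × (C m + B ≤ D m + A)

  GapGrows : ℕ → ℕ → Set
  GapGrows s t = C s + D t ≤ C t + D s

  gapGrows-refl : ∀ s → GapGrows s s
  gapGrows-refl s = ≤-refl

  gapGrows-trans : ∀ {s t u} → GapGrows s t → GapGrows t u → GapGrows s u
  gapGrows-trans {s} {t} {u} st tu = +-cancelʳ-≤ (D t + C t) (C s + D u) (C u + D s) (begin
      C s + D u + (D t + C t)   ≡⟨ solve 4 (λ a b c e → a :+ e :+ (b :+ c) := a :+ b :+ (c :+ e))
                                          refl (C s) (D t) (C t) (D u) ⟩
      C s + D t + (C t + D u)   ≤⟨ +-mono-≤ st tu ⟩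
      C t + D s + (C u + D t)   ≡⟨ solve 4 (λ b c d f → c :+ d :+ (f :+ b) := f :+ d :+ (b :+ c))
                                          refl (D t) (C t) (D s) (C u) ⟩
      C u + D s + (D t + C t)   ∎)
    where
      open ≤-Reasoning
      open +-*-Solver

  private
    widen-within : ∀ x u v → suc (x + u) ≤ A → B ≤ x + v → suc u + B ≤ v + A
    widen-within x u v αstep β≮ = begin
        suc u + B         ≤⟨ +-monoʳ-≤ (suc u) β≮ ⟩
        suc u + (x + v)   ≡⟨ cong suc (trans (sym (+-assoc u x v)) (cong (_+ v) (+-comm u x))) ⟩
        suc (x + u) + v   ≤⟨ +-monoˡ-≤ v αstep ⟩
        A + v             ≡⟨ +-comm A v ⟩
        v + A             ∎
      where open ≤-Reasoning

    lagging-impossible : ∀ x u v → suc (x + v) ≤ B → A ≤ x + u → u + B ≤ v + A → ⊥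
    lagging-impossible x u v βstep α≮ within = 1+n≰n (begin
        suc (x + v + u)   ≤⟨ +-monoˡ-≤ u βstep ⟩
        B + u             ≡⟨ +-comm B u ⟩
        u + B             ≤⟨ within ⟩
        v + A             ≤⟨ +-monoʳ-≤ v α≮ ⟩
        v + (x + u)       ≡⟨ trans (sym (+-assoc v x u)) (cong (_+ u) (+-comm v x)) ⟩
        x + v + u         ∎)
      where open ≤-Reasoning

  gap-step : ∀ m → (i < m → at α m ≡ at β m) → GapWithin m →
             GapWithin (suc m) × GapGrows m (suc m)
  gap-step m agree (D≤C , within) with m ≤? i
  ... | yes m≤i
    rewrite c-below α i (suc m) (s≤s m≤i) | c-below β i (suc m) (s≤s m≤i)
          | c-below α i m (m≤n⇒m≤1+n m≤i) | c-below β i m (m≤n⇒m≤1+n m≤i)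
    = (z≤n , βᵢ≤αᵢ) , z≤n
  ... | no m≰i = compare (at α m + C m <? A) (at β m + D m <? B)
    where
      i<m : i < m
      i<m = ≰⇒> m≰i

      βₘ≡αₘ : at β m ≡ at α m
      βₘ≡αₘ = sym (agree i<m)

      compare : Dec (at α m + C m < A) → Dec (at β m + D m < B) →
                GapWithin (suc m) × GapGrows m (suc m)
      compare (yes αstep) (yes βstep)
        rewrite c-suc-inc α i m i<m αstep | c-suc-inc β i m i<m βstep
        = (s≤s D≤C , s≤s within) , ≤-reflexive (+-suc (C m) (D m))
      compare (no α≮) (no β≮)
        rewrite c-suc-stay α i m i<m α≮ | c-suc-stay β i m i<m β≮
        = (D≤C , within) , ≤-refl
      compare (yes αstep) (no β≮)
        rewrite c-suc-inc α i m i<m αstep | c-suc-stay β i m i<m β≮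
        = (m≤n⇒m≤1+n D≤C
          , widen-within (at α m) (C m) (D m) αstep
              (subst (λ y → B ≤ y + D m) βₘ≡αₘ (≮⇒≥ β≮)))
        , +-monoˡ-≤ (D m) (n≤1+n (C m))
      compare (no α≮) (yes βstep) = ⊥-elim
        (lagging-impossible (at α m) (C m) (D m)
          (subst (λ y → suc (y + D m) ≤ B) βₘ≡αₘ βstep) (≮⇒≥ α≮) within)

  gap-run : ∀ s t → s ≤ t → (∀ m → s ≤ m → m < t → i < m → at α m ≡ at β m) →
            GapWithin s → GapWithin t × GapGrows s t
  gap-run s zero    z≤n  _     within = within , gapGrows-refl s
  gap-run s (suc t) s≤1+t agree within with m≤n⇒m<n∨m≡n s≤1+t
  ... | inj₂ refl = within , gapGrows-refl s
  ... | inj₁ (s≤s s≤t) =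
    let (withinₜ , growsₛₜ) = gap-run s t s≤t (λ m s≤m m<t → agree m s≤m (m<n⇒m<1+n m<t)) within
        (within₁₊ₜ , growsₜ) = gap-step t (agree t s≤t (n<1+n t)) withinₜ
    in within₁₊ₜ , gapGrows-trans {s} {t} {suc t} growsₛₜ growsₜ

module Covering {α α' : Composition} {i j : ℕ} (cov : Covers α α' i j) where

  open Covers cov

  α'ᵢ<αᵢ : at α' i < at α i
  α'ᵢ<αᵢ = subst (_≤ at α i) (+-comm (at α' i) 1) a1

  open GapComparison α α' i (<⇒≤ α'ᵢ<αᵢ)

  agree-off : ∀ m → i < m → m ≢ j → at α m ≡ at α' m
  agree-off m i<m m≢j = sym (a3 m (≤-trans pos (<⇒≤ i<m)) (λ m≡i → <-irrefl (sym m≡i) i<m) m≢j)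

  agree-before : ∀ m → m < j → i < m → at α m ≡ at α' m
  agree-before m m<j i<m = agree-off m i<m (λ m≡j → <-irrefl m≡j m<j)

  agree-after : ∀ m → j < m → i < m → at α m ≡ at α' m
  agree-after m j<m i<m = agree-off m i<m (λ m≡j → <-irrefl (sym m≡j) j<m)

  c-agree-at-j : c α i j ≡ c α' i j
  c-agree-at-j = +-cancelʳ-≡ (at α j) (c α i j) (c α' i j) (trans a4 (sym a4'))

  c-agree-upto-j : ∀ k → k ≤ j → c α i k ≡ c α' i k
  c-agree-upto-j k k≤j = ≤-antisym C≤D D≤C
    where
      run₀ : GapWithin k × GapGrows 0 k
      run₀ = gap-run 0 k z≤n (λ m _ m<k → agree-before m (<-≤-trans m<k k≤j)) (z≤n , <⇒≤ α'ᵢ<αᵢ)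
      D≤C : c α' i k ≤ c α i k
      D≤C = proj₁ (proj₁ run₀)
      growsₖⱼ : GapGrows k j
      growsₖⱼ = proj₂ (gap-run k j k≤j (λ m _ → agree-before m) (proj₁ run₀))
      C≤D : c α i k ≤ c α' i k
      C≤D = +-cancelʳ-≤ (c α' i j) (c α i k) (c α' i k)
        (subst (c α i k + c α' i j ≤_)
          (trans (cong (_+ c α' i k) c-agree-at-j) (+-comm (c α' i j) (c α' i k))) growsₖⱼ)

  αⱼ-steps : at α j + c α i j < at α i
  αⱼ-steps = subst (_< at α i) (trans (sym a4) (+-comm (c α i j) (at α j))) α'ᵢ<αᵢ

  α'ⱼ-stays : ¬ (at α' j + c α' i j < at α' i)
  α'ⱼ-stays βstep = <⇒≱ α'ᵢ<αᵢ (+-cancelʳ-≤ (at α j) (at α i) (at α' i) (begin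
      at α i + at α j                          ≡⟨ +-comm (at α i) (at α j) ⟩
      at α j + at α i                          ≡⟨ sym a2 ⟩
      at α' j + at α' i + 1                    ≡⟨ cong (λ y → at α' j + y + 1) (sym a4') ⟩
      at α' j + (c α' i j + at α j) + 1        ≡⟨ +-comm (at α' j + (c α' i j + at α j)) 1 ⟩
      suc (at α' j + (c α' i j + at α j))      ≡⟨ cong suc (sym (+-assoc (at α' j) (c α' i j) (at α j))) ⟩
      suc (at α' j + c α' i j) + at α j        ≤⟨ +-monoˡ-≤ (at α j) βstep ⟩
      at α' i + at α j                         ∎))
    where open ≤-Reasoning

  c-suc-j : c α i (suc j) ≡ 1 + c α i j
  c-suc-j = c-suc-inc α i j i<j αⱼ-steps

  c'-suc-j : c α' i (suc j) ≡ c α' i j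
  c'-suc-j = c-suc-stay α' i j i<j α'ⱼ-stays

  c-gap-after-j : ∀ k → k > j → c α i k > c α' i k
  c-gap-after-j k j<k = +-cancelʳ-≤ (c α i j) (suc (c α' i k)) (c α i k) (shift growsⱼ₊₁ₖ)
    where
      within₁₊ⱼ : GapWithin (suc j)
      within₁₊ⱼ rewrite c-suc-j | c'-suc-j | c-agree-at-j =
        n≤1+n (c α' i j)
        , subst (_≤ c α' i j + at α i) (+-suc (c α' i j) (at α' i)) (+-monoʳ-≤ (c α' i j) α'ᵢ<αᵢ)
      growsⱼ₊₁ₖ : GapGrows (suc j) k
      growsⱼ₊₁ₖ = proj₂ (gap-run (suc j) k j<k (λ m j<m _ → agree-after m j<m) within₁₊ⱼ)
      shift : GapGrows (suc j) k → suc (c α' i k) + c α i j ≤ c α i k + c α i j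
      shift g rewrite c-suc-j | c'-suc-j | c-agree-at-j =
        subst (_≤ c α i k + c α' i j) (cong suc (+-comm (c α' i j) (c α' i k))) g

  -- Stepping inside the window [α'_i, α_i) would make only the α-counter advance at k,
  -- contradicting (i) at k + 1 ≤ j.
  c-avoids-window : ∀ k → suc i ≤ k → k < j →
                    (at α k + c α i k ≥ at α i) ⊎ (at α k + c α i k < at α' i)
  c-avoids-window k i<k k<j with at α i ≤? at α k + c α i k
  ... | yes above = inj₁ above
  ... | no below with at α' i ≤? at α k + c α i k
  ...   | no  α'ᵢ≰ = inj₂ (≰⇒> α'ᵢ≰)
  ...   | yes α'ᵢ≤ = ⊥-elim (1+n≢n (begin
      suc (c α i k)     ≡⟨ sym (c-suc-inc α i k i<k (≰⇒> below)) ⟩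
      c α i (suc k)     ≡⟨ c-agree-upto-j (suc k) k<j ⟩
      c α' i (suc k)    ≡⟨ c-suc-stay α' i k i<k α'-stays ⟩
      c α' i k          ≡⟨ sym cₖ-agree ⟩
      c α i k           ∎))
    where
      open ≡-Reasoning
      cₖ-agree : c α i k ≡ c α' i k
      cₖ-agree = c-agree-upto-j k (<⇒≤ k<j)
      α'-stays : ¬ (at α' k + c α' i k < at α' i)
      α'-stays lt = <⇒≱ lt (subst (at α' i ≤_) (cong₂ _+_ (agree-before k k<j i<k) cₖ-agree) α'ᵢ≤)

proposition3p3 : (α α' : Composition) (i j : ℕ) → Covers α α' i j →
    ((k : ℕ) → suc i ≤ k → k ≤ j → c α i k ≡ c α' i k)
    × ((c α i (suc j) ≡ 1 + c α i j) × (c α' i (suc j) ≡ c α' i j))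
    × ((k : ℕ) → k > j → c α i k > c α' i k)
    × ((k : ℕ) → suc i ≤ k → k < j →
        (at α k + c α i k ≥ at α i) ⊎ (at α k + c α i k < at α' i))
proposition3p3 α α' i j cov =
    (λ k _ → c-agree-upto-j k)
  , (c-suc-j , c'-suc-j)
  , c-gap-after-j
  , c-avoids-window
  where open Covering cov
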